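{- In a read-once branching program of width $w$ with at most $\ell$ colliding layers, every vertex $v$ with $p_v>0$ satisfies $p_v\ge2^{ -(\ell+1)\cdot(w-1)}$, where $p_v$ is the probability of reaching $v$ when the input is uniformly random.
   Context: A read-once branching program of width $w$ is a layered directed graph whose first layer is a single start vertex, each layer has at most $w$ vertices, each vertex (except in the last layer) has exactly two outgoing edges into the next layer, one labeled $1$ and one labeled $-1$, and the $i$-th layer of edges is followed according to the $i$-th input bit. A layer of edges is colliding if two edges carrying the same label enter the same vertex of the next layer. -}

module Defs where

open import Data.Nat using (ℕ; zero; suc; _≤_; _<_)
open import Data.Nat.Properties using (<⇒≤)
open import Data.Fin using (Fin; toℕ; fromℕ<; _≟_)
open import Data.Fin.Properties using (any?; toℕ<n)
open import Data.Vec using (Vec; []; _∷_; lookup)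
open import Data.List using (List; [_]; map; _++_; filter; length; allFin)
open import Data.Product using (Σ; ∃; _×_; _,_)
open import Data.Sum using (_⊎_; inj₁; inj₂)
open import Relation.Nullary using (¬_; Dec; yes; no; ¬?; _×-dec_)
open import Relation.Binary.PropositionalEquality using (_≡_; refl; subst; sym)

-- Edge labels: 1 and -1.
data Label : Set where
  pos neg : Label

-- The layer of edges number i (i < n) goes from vertex layer i to vertex
-- layer i+1 and is followed according to input bit i.
record BP (n w : ℕ) : Set where
  field
    size  : ℕ → ℕ
    size0 : size 0 ≡ 1
    width : ∀ i → i ≤ n → size i ≤ w
    next  : (i : ℕ) → i < n → Fin (size i) → Label → Fin (size (suc i))

  start : Fin (size 0)
  start = subst Fin (sym size0) Fin.zero

  reach : Vec Label n → (k : ℕ) → k ≤ n → Fin (size k)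
  reach x zero _ = start
  reach x (suc k) p = next k p (reach x k (<⇒≤ p)) (lookup x (fromℕ< p))

  -- edge layer i is colliding: two distinct edges carrying the same label
  -- enter the same vertex (distinct same-label edges = distinct sources)
  Colliding : Fin n → Set
  Colliding i = Σ (Fin (size (toℕ i))) λ u → Σ (Fin (size (toℕ i))) λ u' →
    Σ Label λ b → (¬ u ≡ u') × (next (toℕ i) (toℕ<n i) u b ≡ next (toℕ i) (toℕ<n i) u' b)

  colliding? : (i : Fin n) → Dec (Colliding i)
  colliding? i = any? λ u → any? λ u' → lab? u u'
    where
    nx = next (toℕ i) (toℕ<n i)
    lab? : ∀ u u' → Dec (Σ Label λ b → (¬ u ≡ u') × (nx u b ≡ nx u' b))
    lab? u u' with ¬? (u ≟ u') ×-dec (nx u pos ≟ nx u' pos)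
                 | ¬? (u ≟ u') ×-dec (nx u neg ≟ nx u' neg)
    ... | yes q | _ = yes (pos , q)
    ... | no _ | yes r = yes (neg , r)
    ... | no a | no c = no λ { (pos , q) → a q ; (neg , r) → c r }

  numColliding : ℕ
  numColliding = length (filter colliding? (allFin n))

allInputs : (n : ℕ) → List (Vec Label n)
allInputs zero = [ [] ]
allInputs (suc n) = map (pos ∷_) (allInputs n) ++ map (neg ∷_) (allInputs n)

-- number of inputs reaching vertex v of layer k;  p_v = hits / 2^n
hits : ∀ {n w} (B : BP n w) (k : ℕ) (p : k ≤ n) → Fin (BP.size B k) → ℕ
hits {n} B k p v = length (filter (λ x → BP.reach B x k p ≟ v) (allInputs n))

-- Write E_k = A_k (w - 1) + c_k, where A_k counts the colliding layers among the first k and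
-- c_k is the number of vertices of layer k reached by some input. By induction on k, every
-- reached vertex v of layer k is reached by at least 2^(n + 1 - E_k) inputs. Reading bit k sends
-- exactly half of the inputs reaching a vertex along each of its edges, because flipping bit k
-- is a bijection of the inputs that does not move them in the layers before k. If only one
-- vertex t of layer k + 1 is reached, all inputs reach it. Otherwise t inherits half of the
-- inputs of a reached u. For a colliding layer E grows, as c_k ≤ w and c_(k+1) ≥ 2. For a
-- non-colliding layer the edges of each label act injectively, so either t also inherits half
-- of the inputs of a second reached vertex along the other label, and c does not decrease, or t
-- is missed by the reached vertices along that label, and c increases. Finally E_k ≤ ℓ (w - 1) + w.
module Submission where

open import Defs
open import Data.Bool using (true; if_then_else_)
open import Data.Empty using (⊥-elim)
open import Data.Fin as Fin using (Fin; zero; suc; toℕ; fromℕ<)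
open import Data.Fin.Properties as Finₚ using (any?; toℕ<n; toℕ-fromℕ<)
open import Data.Fin.Subset using (Subset; _∈_; ∣_∣; _-_; inside; outside)
open import Data.Fin.Subset.Properties using (∣p∣≤n; x∈p⇒∣p-x∣<∣p∣; x∈p∧x≢y⇒x∈p-y)
open import Data.List using (List; []; _∷_; map; _++_; filter; length; allFin)
open import Data.List.Properties using (filter-++; length-++)
open import Data.List.Membership.Propositional using () renaming (_∈_ to _∈ˡ_)
open import Data.List.Membership.Propositional.Properties using (∈-allFin)
open import Data.List.Relation.Unary.Any as Any using ()
open import Data.Nat hiding (∣_-_∣)
open import Data.Nat.Properties
open import Data.Nat.Tactic.RingSolver using (solve-∀)
open import Data.Product using (∃; ∃₂; _×_; _,_; proj₁)
open import Data.Vec using (Vec; []; _∷_; lookup; updateAt; tabulate; here; there)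
open import Data.Vec.Properties using (lookup∘updateAt; lookup∘updateAt′; lookup⇒[]=; []=⇒lookup; lookup∘tabulate)
open import Function using (_∘_)
open import Function.Definitions using (Injective)
open import Level using (0ℓ)
open import Relation.Binary.PropositionalEquality
open import Relation.Nullary using (¬_; Dec; yes; no; does; _×-dec_)
open import Relation.Nullary.Decidable using (dec-true)
open import Relation.Unary using (Pred; Decidable)

open import Algebra.Properties.CommutativeSemigroup +-commutativeSemigroup using (interchange)

private variable
  A B C : Set

opposite : Label → Label
opposite pos = neg
opposite neg = pos

_≟ᴸ_ : (a b : Label) → Dec (a ≡ b)
pos ≟ᴸ pos = yes refl
pos ≟ᴸ neg = no λ ()
neg ≟ᴸ pos = no λ ()
neg ≟ᴸ neg = yes refl

≢opposite : ∀ b → b ≢ opposite b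
≢opposite pos ()
≢opposite neg ()

-- Through does only, so that decisions differing in their evidence have the same indicator.
𝟙 : Dec A → ℕ
𝟙 a? = if does a? then 1 else 0

𝟙-yes : (a? : Dec A) → A → 𝟙 a? ≡ 1
𝟙-yes a? a rewrite dec-true a? a = refl

𝟙-positive : (a? : Dec A) → 0 < 𝟙 a? → A
𝟙-positive (yes a) _ = a

𝟙-mono : (A → B) → (a? : Dec A) (b? : Dec B) → 𝟙 a? ≤ 𝟙 b?
𝟙-mono f (yes a) (yes _) = ≤-refl
𝟙-mono f (yes a) (no ¬b) = ⊥-elim (¬b (f a))
𝟙-mono f (no _)  _       = z≤n

𝟙-disjoint : (A → C) → (B → C) → (A → ¬ B) →
  (a? : Dec A) (b? : Dec B) (c? : Dec C) → 𝟙 a? + 𝟙 b? ≤ 𝟙 c?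
𝟙-disjoint f g ¬ab (yes a) (yes b) c? = ⊥-elim (¬ab a b)
𝟙-disjoint f g ¬ab (yes a) (no _)  c? = 𝟙-mono f (yes a) c?
𝟙-disjoint f g ¬ab (no _)  (yes b) c? = 𝟙-mono g (yes b) c?
𝟙-disjoint f g ¬ab (no _)  (no _)  c? = z≤n

𝟙-split-Label : (a? : Dec A) (ℓ : Label) → 𝟙 a? ≡ 𝟙 (a? ×-dec ℓ ≟ᴸ pos) + 𝟙 (a? ×-dec ℓ ≟ᴸ neg)
𝟙-split-Label (yes _) pos = refl
𝟙-split-Label (yes _) neg = refl
𝟙-split-Label (no _)  _   = refl

𝟙-opposite : (a? : Dec A) (ℓ b : Label) → 𝟙 (a? ×-dec opposite ℓ ≟ᴸ opposite b) ≡ 𝟙 (a? ×-dec ℓ ≟ᴸ b)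
𝟙-opposite a? pos pos = refl
𝟙-opposite a? pos neg = refl
𝟙-opposite a? neg pos = refl
𝟙-opposite a? neg neg = refl

module _ {P Q : Pred A 0ℓ} (P? : Decidable P) (Q? : Decidable Q) (P⊆Q : ∀ {x} → P x → Q x) where

  length-filter-mono : ∀ xs → length (filter P? xs) ≤ length (filter Q? xs)
  length-filter-mono []       = z≤n
  length-filter-mono (x ∷ xs) with P? x | Q? x
  ... | yes _ | yes _  = s≤s (length-filter-mono xs)
  ... | yes p | no ¬q  = ⊥-elim (¬q (P⊆Q p))
  ... | no _  | yes _  = m≤n⇒m≤1+n (length-filter-mono xs)
  ... | no _  | no _   = length-filter-mono xs

  length-filter-mono-< : ∀ {x xs} → x ∈ˡ xs → Q x → ¬ P x →
    length (filter P? xs) < length (filter Q? xs)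
  length-filter-mono-< {x} {x ∷ xs} (Any.here refl) qx ¬px with P? x | Q? x
  ... | yes px | _     = ⊥-elim (¬px px)
  ... | no _   | yes _ = s≤s (length-filter-mono xs)
  ... | no _   | no ¬q = ⊥-elim (¬q qx)
  length-filter-mono-< {xs = y ∷ xs} (Any.there x∈xs) qx ¬px with P? y | Q? y
  ... | yes _ | yes _  = s≤s (length-filter-mono-< x∈xs qx ¬px)
  ... | yes p | no ¬q  = ⊥-elim (¬q (P⊆Q p))
  ... | no _  | yes _  = m≤n⇒m≤1+n (length-filter-mono-< x∈xs qx ¬px)
  ... | no _  | no _   = length-filter-mono-< x∈xs qx ¬px

length-filter-map : {P : Pred B 0ℓ} (P? : Decidable P) (f : A → B) (xs : List A) →
  length (filter P? (map f xs)) ≡ length (filter (P? ∘ f) xs)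
length-filter-map P? f []       = refl
length-filter-map P? f (x ∷ xs) with P? (f x)
... | yes _ = cong suc (length-filter-map P? f xs)
... | no _  = length-filter-map P? f xs

-- Subsets of Fin and injections

subset : ∀ {m} {P : Pred (Fin m) 0ℓ} → Decidable P → Subset m
subset P? = tabulate (does ∘ P?)

module _ {m} {P : Pred (Fin m) 0ℓ} (P? : Decidable P) where

  ∈-subset⁺ : ∀ {x} → P x → x ∈ subset P?
  ∈-subset⁺ {x} px = lookup⇒[]= x _ (trans (lookup∘tabulate (does ∘ P?) x) (dec-true (P? x) px))

  ∈-subset⁻ : ∀ {x} → x ∈ subset P? → P x
  ∈-subset⁻ {x} x∈ = does-true (P? x) (trans (sym (lookup∘tabulate (does ∘ P?) x)) ([]=⇒lookup x∈))
    where
    does-true : (d : Dec (P x)) → does d ≡ true → P x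
    does-true (yes px) _ = px

injection⇒∣p∣≤∣q∣ : ∀ {m m'} {p : Subset m} {q : Subset m'} (f : Fin m → Fin m') →
  Injective _≡_ _≡_ f → (∀ {x} → x ∈ p → f x ∈ q) → ∣ p ∣ ≤ ∣ q ∣
injection⇒∣p∣≤∣q∣ {p = []} f inj f∈ = z≤n
injection⇒∣p∣≤∣q∣ {p = outside ∷ p} f inj f∈ =
  injection⇒∣p∣≤∣q∣ (f ∘ suc) (Finₚ.suc-injective ∘ inj) (f∈ ∘ there)
injection⇒∣p∣≤∣q∣ {p = inside ∷ p} {q} f inj f∈ = begin-strict
  ∣ p ∣          ≤⟨ injection⇒∣p∣≤∣q∣ (f ∘ suc) (Finₚ.suc-injective ∘ inj) f[p]⊆q-f0 ⟩
  ∣ q - f zero ∣ <⟨ x∈p⇒∣p-x∣<∣p∣ (f∈ here) ⟩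
  ∣ q ∣          ∎
  where
  open ≤-Reasoning
  f[p]⊆q-f0 : ∀ {x} → x ∈ p → f (suc x) ∈ q - f zero
  f[p]⊆q-f0 x∈p = x∈p∧x≢y⇒x∈p-y (f∈ (there x∈p)) (λ e → Finₚ.0≢1+n (inj (sym e)))

injection-missing⇒∣p∣<∣q∣ : ∀ {m m'} {p : Subset m} {q : Subset m'} (f : Fin m → Fin m') →
  Injective _≡_ _≡_ f → (∀ {x} → x ∈ p → f x ∈ q) →
  ∀ {t} → t ∈ q → (∀ {x} → x ∈ p → f x ≢ t) → ∣ p ∣ < ∣ q ∣
injection-missing⇒∣p∣<∣q∣ f inj f∈ t∈q f≢t = ≤-<-trans
  (injection⇒∣p∣≤∣q∣ f inj (λ x∈p → x∈p∧x≢y⇒x∈p-y (f∈ x∈p) (f≢t x∈p)))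
  (x∈p⇒∣p-x∣<∣p∣ t∈q)

∣p∣≤1⇒∈-unique : ∀ {m} {p : Subset m} {x y} → ∣ p ∣ ≤ 1 → x ∈ p → y ∈ p → x ≡ y
∣p∣≤1⇒∈-unique {x = x} {y} ∣p∣≤1 x∈p y∈p with x Fin.≟ y
... | yes x≡y = x≡y
... | no  x≢y = ⊥-elim (n≮0 (<-≤-trans (x∈p⇒∣p-x∣<∣p∣ (x∈p∧x≢y⇒x∈p-y x∈p x≢y))
                                      (s≤s⁻¹ (≤-trans (x∈p⇒∣p-x∣<∣p∣ y∈p) ∣p∣≤1))))

-- Sums over all inputs

∑ : ∀ {n} → (Vec Label n → ℕ) → ℕ
∑ {zero}  f = f []
∑ {suc n} f = ∑ (f ∘ (pos ∷_)) + ∑ (f ∘ (neg ∷_))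

∑-cong : ∀ {n} {f g : Vec Label n → ℕ} → (∀ x → f x ≡ g x) → ∑ f ≡ ∑ g
∑-cong {zero}  eq = eq []
∑-cong {suc n} eq = cong₂ _+_ (∑-cong (eq ∘ (pos ∷_))) (∑-cong (eq ∘ (neg ∷_)))

∑-mono-≤ : ∀ {n} {f g : Vec Label n → ℕ} → (∀ x → f x ≤ g x) → ∑ f ≤ ∑ g
∑-mono-≤ {zero}  le = le []
∑-mono-≤ {suc n} le = +-mono-≤ (∑-mono-≤ (le ∘ (pos ∷_))) (∑-mono-≤ (le ∘ (neg ∷_)))

∑-distrib-+ : ∀ {n} (f g : Vec Label n → ℕ) → ∑ (λ x → f x + g x) ≡ ∑ f + ∑ g
∑-distrib-+ {zero}  f g = refl
∑-distrib-+ {suc n} f g = begin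
  ∑ (λ x → f (pos ∷ x) + g (pos ∷ x)) + ∑ (λ x → f (neg ∷ x) + g (neg ∷ x))
    ≡⟨ cong₂ _+_ (∑-distrib-+ (f ∘ (pos ∷_)) (g ∘ (pos ∷_))) (∑-distrib-+ (f ∘ (neg ∷_)) (g ∘ (neg ∷_))) ⟩
  (∑ (f ∘ (pos ∷_)) + ∑ (g ∘ (pos ∷_))) + (∑ (f ∘ (neg ∷_)) + ∑ (g ∘ (neg ∷_)))
    ≡⟨ interchange (∑ (f ∘ (pos ∷_))) (∑ (g ∘ (pos ∷_))) (∑ (f ∘ (neg ∷_))) (∑ (g ∘ (neg ∷_))) ⟩
  ∑ f + ∑ g ∎
  where open ≡-Reasoning

≤∑ : ∀ {n} (f : Vec Label n → ℕ) x → f x ≤ ∑ f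
≤∑ f []        = ≤-refl
≤∑ f (pos ∷ x) = ≤-trans (≤∑ (f ∘ (pos ∷_)) x) (m≤m+n _ _)
≤∑ f (neg ∷ x) = ≤-trans (≤∑ (f ∘ (neg ∷_)) x) (m≤n+m _ _)

∑-positive : ∀ {n} {f : Vec Label n → ℕ} → 0 < ∑ f → ∃ λ x → 0 < f x
∑-positive {zero}  0<f = [] , 0<f
∑-positive {suc n} {f} 0<∑ with ∑ (f ∘ (pos ∷_)) in eq
... | suc _ = let x , 0<fx = ∑-positive (subst (0 <_) (sym eq) z<s) in pos ∷ x , 0<fx
... | zero  = let x , 0<fx = ∑-positive 0<∑ in neg ∷ x , 0<fx

∑-1 : ∀ n → ∑ {n} (λ _ → 1) ≡ 2 ^ n
∑-1 zero    = refl
∑-1 (suc n) = trans (cong₂ _+_ (∑-1 n) (∑-1 n)) (cong (2 ^ n +_) (sym (+-identityʳ (2 ^ n))))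

∑-updateAt-opposite : ∀ {n} (i : Fin n) (f : Vec Label n → ℕ) →
  ∑ (λ x → f (updateAt x i opposite)) ≡ ∑ f
∑-updateAt-opposite zero    f = +-comm (∑ (f ∘ (neg ∷_))) (∑ (f ∘ (pos ∷_)))
∑-updateAt-opposite (suc i) f =
  cong₂ _+_ (∑-updateAt-opposite i (f ∘ (pos ∷_))) (∑-updateAt-opposite i (f ∘ (neg ∷_)))

length-filter-allInputs : ∀ {n} {P : Pred (Vec Label n) 0ℓ} (P? : Decidable P) →
  length (filter P? (allInputs n)) ≡ ∑ (𝟙 ∘ P?)
length-filter-allInputs {zero} P? with P? []
... | yes _ = refl
... | no _  = refl
length-filter-allInputs {suc n} P? = begin
  length (filter P? (map (pos ∷_) (allInputs n) ++ map (neg ∷_) (allInputs n)))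
    ≡⟨ cong length (filter-++ P? (map (pos ∷_) (allInputs n)) _) ⟩
  length (filter P? (map (pos ∷_) (allInputs n)) ++ filter P? (map (neg ∷_) (allInputs n)))
    ≡⟨ length-++ (filter P? (map (pos ∷_) (allInputs n))) ⟩
  length (filter P? (map (pos ∷_) (allInputs n))) + length (filter P? (map (neg ∷_) (allInputs n)))
    ≡⟨ cong₂ _+_ (length-filter-map P? (pos ∷_) (allInputs n)) (length-filter-map P? (neg ∷_) (allInputs n)) ⟩
  length (filter (P? ∘ (pos ∷_)) (allInputs n)) + length (filter (P? ∘ (neg ∷_)) (allInputs n))
    ≡⟨ cong₂ _+_ (length-filter-allInputs (P? ∘ (pos ∷_))) (length-filter-allInputs (P? ∘ (neg ∷_))) ⟩
  ∑ (𝟙 ∘ P?) ∎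
  where open ≡-Reasoning

halve-≤ : ∀ {X} a b E → X ≤ a * 2 ^ E → a ≤ 2 * b → X ≤ b * 2 ^ suc E
halve-≤ {X} a b E X≤ a≤ = begin
  X             ≤⟨ X≤ ⟩
  a * 2 ^ E     ≤⟨ *-monoˡ-≤ (2 ^ E) a≤ ⟩
  2 * b * 2 ^ E ≡⟨ reassoc b (2 ^ E) ⟩
  b * 2 ^ suc E ∎
  where
  open ≤-Reasoning
  reassoc : ∀ b y → 2 * b * y ≡ b * (2 * y)
  reassoc = solve-∀

average-≤ : ∀ {X} a a' b E → X ≤ a * 2 ^ E → X ≤ a' * 2 ^ E → a + a' ≤ 2 * b → X ≤ b * 2 ^ E
average-≤ {X} a a' b E X≤ X≤' a+a'≤ = *-cancelˡ-≤ 2 (begin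
  2 * X                     ≡⟨ cong (X +_) (+-identityʳ X) ⟩
  X + X                     ≤⟨ +-mono-≤ X≤ X≤' ⟩
  a * 2 ^ E + a' * 2 ^ E    ≡⟨ *-distribʳ-+ (2 ^ E) a a' ⟨
  (a + a') * 2 ^ E          ≤⟨ *-monoˡ-≤ (2 ^ E) a+a'≤ ⟩
  2 * b * 2 ^ E             ≡⟨ *-assoc 2 b (2 ^ E) ⟩
  2 * (b * 2 ^ E)           ∎)
  where open ≤-Reasoning

raise-≤ : ∀ {X} b E E' → X ≤ b * 2 ^ E → E ≤ E' → X ≤ b * 2 ^ E'
raise-≤ b E E' X≤ E≤E' = ≤-trans X≤ (*-monoʳ-≤ b (^-monoʳ-≤ 2 E≤E'))

-- Read-once branching programs

module _ {n w : ℕ} (B : BP n w) where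
  open BP B

  reach-updateAt : ∀ x (i : Fin n) g k (q : k ≤ n) → k ≤ toℕ i →
    reach (updateAt x i g) k q ≡ reach x k q
  reach-updateAt x i g zero    q k≤i = refl
  reach-updateAt x i g (suc k) q k<i =
    cong₂ (next k q) (reach-updateAt x i g k (<⇒≤ q) (<⇒≤ k<i))
                     (lookup∘updateAt′ (fromℕ< q) i k≢i x)
    where
    k≢i : fromℕ< q ≢ i
    k≢i e = <-irrefl (trans (sym (toℕ-fromℕ< q)) (cong toℕ e)) k<i

  hits-∑ : ∀ k q v → hits B k q v ≡ ∑ λ x → 𝟙 (reach x k q Fin.≟ v)
  hits-∑ k q v = length-filter-allInputs (λ x → reach x k q Fin.≟ v)

  reach-hits : ∀ x k q → 0 < hits B k q (reach x k q)
  reach-hits x k q = subst (0 <_) (sym (hits-∑ k q (reach x k q)))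
    (≤-trans (≤-reflexive (sym (𝟙-yes (reach x k q Fin.≟ reach x k q) refl)))
             (≤∑ (λ y → 𝟙 (reach y k q Fin.≟ reach x k q)) x))

  hits-all : ∀ k q v → (∀ x → reach x k q ≡ v) → hits B k q v ≡ 2 ^ n
  hits-all k q v all = begin
    hits B k q v                       ≡⟨ hits-∑ k q v ⟩
    ∑ (λ x → 𝟙 (reach x k q Fin.≟ v)) ≡⟨ ∑-cong (λ x → 𝟙-yes (reach x k q Fin.≟ v) (all x)) ⟩
    ∑ {n} (λ _ → 1)                    ≡⟨ ∑-1 n ⟩
    2 ^ n                              ∎
    where open ≡-Reasoning

  hit-predecessor : ∀ k (p : k < n) t → 0 < hits B (suc k) p t →
    ∃₂ λ u b → next k p u b ≡ t × 0 < hits B k (<⇒≤ p) u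
  hit-predecessor k p t t-hit with ∑-positive (subst (0 <_) (hits-∑ (suc k) p t) t-hit)
  ... | x , 0<𝟙 = reach x k (<⇒≤ p) , lookup x (fromℕ< p) ,
                  𝟙-positive (reach x (suc k) p Fin.≟ t) 0<𝟙 , reach-hits x k (<⇒≤ p)

  Traverses : Vec Label n → ∀ k → k < n → Fin (size k) → Label → Set
  Traverses x k p u b = reach x k (<⇒≤ p) ≡ u × lookup x (fromℕ< p) ≡ b

  traverses? : ∀ x k (p : k < n) u b → Dec (Traverses x k p u b)
  traverses? x k p u b = reach x k (<⇒≤ p) Fin.≟ u ×-dec lookup x (fromℕ< p) ≟ᴸ b

  traverses⇒reach-next : ∀ {x k} {p : k < n} {u b} → Traverses x k p u b → reach x (suc k) p ≡ next k p u b
  traverses⇒reach-next (r≡u , ℓ≡b) = cong₂ (next _ _) r≡u ℓ≡b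

  edgeHits : ∀ k (p : k < n) → Fin (size k) → Label → ℕ
  edgeHits k p u b = ∑ λ x → 𝟙 (traverses? x k p u b)

  hits≡edgeHits+edgeHits : ∀ k (p : k < n) u → hits B k (<⇒≤ p) u ≡ edgeHits k p u pos + edgeHits k p u neg
  hits≡edgeHits+edgeHits k p u = begin
    hits B k (<⇒≤ p) u
      ≡⟨ hits-∑ k (<⇒≤ p) u ⟩
    ∑ (λ x → 𝟙 (reach x k (<⇒≤ p) Fin.≟ u))
      ≡⟨ ∑-cong (λ x → 𝟙-split-Label (reach x k (<⇒≤ p) Fin.≟ u) (lookup x (fromℕ< p))) ⟩
    ∑ (λ x → 𝟙 (traverses? x k p u pos) + 𝟙 (traverses? x k p u neg))
      ≡⟨ ∑-distrib-+ (λ x → 𝟙 (traverses? x k p u pos)) (λ x → 𝟙 (traverses? x k p u neg)) ⟩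
    edgeHits k p u pos + edgeHits k p u neg ∎
    where open ≡-Reasoning

  edgeHits-opposite : ∀ k (p : k < n) u b → edgeHits k p u (opposite b) ≡ edgeHits k p u b
  edgeHits-opposite k p u b = begin
    edgeHits k p u (opposite b)
      ≡⟨ ∑-updateAt-opposite i (λ x → 𝟙 (traverses? x k p u (opposite b))) ⟨
    ∑ (λ x → 𝟙 (traverses? (updateAt x i opposite) k p u (opposite b)))
      ≡⟨ ∑-cong flip-bit ⟩
    edgeHits k p u b ∎
    where
    open ≡-Reasoning
    i = fromℕ< p
    flip-bit : ∀ x → 𝟙 (traverses? (updateAt x i opposite) k p u (opposite b)) ≡ 𝟙 (traverses? x k p u b)
    flip-bit x rewrite reach-updateAt x i opposite k (<⇒≤ p) (≤-reflexive (sym (toℕ-fromℕ< p)))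
                     | lookup∘updateAt i {opposite} x
      = 𝟙-opposite (reach x k (<⇒≤ p) Fin.≟ u) (lookup x i) b

  hits≡2*edgeHits : ∀ k (p : k < n) u b → hits B k (<⇒≤ p) u ≡ 2 * edgeHits k p u b
  hits≡2*edgeHits k p u pos = trans (hits≡edgeHits+edgeHits k p u)
    (cong (edgeHits k p u pos +_) (trans (edgeHits-opposite k p u pos) (sym (+-identityʳ _))))
  hits≡2*edgeHits k p u neg = trans (hits≡edgeHits+edgeHits k p u)
    (cong₂ _+_ (edgeHits-opposite k p u neg) (sym (+-identityʳ _)))

  edgeHits≤hits-next : ∀ k (p : k < n) u b → edgeHits k p u b ≤ hits B (suc k) p (next k p u b)
  edgeHits≤hits-next k p u b = begin
    edgeHits k p u b
      ≤⟨ ∑-mono-≤ (λ x → 𝟙-mono traverses⇒reach-next (traverses? x k p u b) (reach x (suc k) p Fin.≟ next k p u b)) ⟩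
    ∑ (λ x → 𝟙 (reach x (suc k) p Fin.≟ next k p u b))
      ≡⟨ hits-∑ (suc k) p (next k p u b) ⟨
    hits B (suc k) p (next k p u b) ∎
    where open ≤-Reasoning

  edgeHits+edgeHits≤hits-next : ∀ k (p : k < n) {u u'} b → next k p u b ≡ next k p u' (opposite b) →
    edgeHits k p u b + edgeHits k p u' (opposite b) ≤ hits B (suc k) p (next k p u b)
  edgeHits+edgeHits≤hits-next k p {u} {u'} b e = begin
    edgeHits k p u b + edgeHits k p u' (opposite b)
      ≡⟨ ∑-distrib-+ (λ x → 𝟙 (traverses? x k p u b)) (λ x → 𝟙 (traverses? x k p u' (opposite b))) ⟨
    ∑ (λ x → 𝟙 (traverses? x k p u b) + 𝟙 (traverses? x k p u' (opposite b)))
      ≤⟨ ∑-mono-≤ (λ x → 𝟙-disjoint traverses⇒reach-next (λ tr → trans (traverses⇒reach-next tr) (sym e))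
                     (λ (_ , ℓ≡b) (_ , ℓ≡b') → ≢opposite b (trans (sym ℓ≡b) ℓ≡b'))
                     (traverses? x k p u b) (traverses? x k p u' (opposite b))
                     (reach x (suc k) p Fin.≟ next k p u b)) ⟩
    ∑ (λ x → 𝟙 (reach x (suc k) p Fin.≟ next k p u b))
      ≡⟨ hits-∑ (suc k) p (next k p u b) ⟨
    hits B (suc k) p (next k p u b) ∎
    where open ≤-Reasoning

  hits≤2*hits-next : ∀ k (p : k < n) u b → hits B k (<⇒≤ p) u ≤ 2 * hits B (suc k) p (next k p u b)
  hits≤2*hits-next k p u b = begin
    hits B k (<⇒≤ p) u                  ≡⟨ hits≡2*edgeHits k p u b ⟩
    2 * edgeHits k p u b                ≤⟨ *-monoʳ-≤ 2 (edgeHits≤hits-next k p u b) ⟩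
    2 * hits B (suc k) p (next k p u b) ∎
    where open ≤-Reasoning

  hits+hits≤2*hits-next : ∀ k (p : k < n) {u u'} b → next k p u b ≡ next k p u' (opposite b) →
    hits B k (<⇒≤ p) u + hits B k (<⇒≤ p) u' ≤ 2 * hits B (suc k) p (next k p u b)
  hits+hits≤2*hits-next k p {u} {u'} b e = begin
    hits B k (<⇒≤ p) u + hits B k (<⇒≤ p) u'
      ≡⟨ cong₂ _+_ (hits≡2*edgeHits k p u b) (hits≡2*edgeHits k p u' (opposite b)) ⟩
    2 * edgeHits k p u b + 2 * edgeHits k p u' (opposite b)
      ≡⟨ *-distribˡ-+ 2 (edgeHits k p u b) (edgeHits k p u' (opposite b)) ⟨
    2 * (edgeHits k p u b + edgeHits k p u' (opposite b))
      ≤⟨ *-monoʳ-≤ 2 (edgeHits+edgeHits≤hits-next k p b e) ⟩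
    2 * hits B (suc k) p (next k p u b) ∎
    where open ≤-Reasoning

  collision⇒Colliding : ∀ {k} (p : k < n) {u u' b} → u ≢ u' → next k p u b ≡ next k p u' b →
    Colliding (fromℕ< p)
  collision⇒Colliding {k} p u≢u' e = transport (toℕ-fromℕ< p) (toℕ<n (fromℕ< p)) (_ , _ , _ , u≢u' , e)
    where
    CollidingAt : ∀ j → j < n → Set
    CollidingAt j r = ∃₂ λ u u' → ∃ λ b → u ≢ u' × next j r u b ≡ next j r u' b
    transport : ∀ {j} → j ≡ k → (r : j < n) → CollidingAt k p → CollidingAt j r
    transport refl r rewrite <-irrelevant r p = λ c → c

  ¬Colliding⇒next-injective : ∀ {k} (p : k < n) b → ¬ Colliding (fromℕ< p) → Injective _≡_ _≡_ (λ u → next k p u b)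
  ¬Colliding⇒next-injective p b ¬coll {u} {u'} e with u Fin.≟ u'
  ... | yes u≡u' = u≡u'
  ... | no u≢u'  = ⊥-elim (¬coll (collision⇒Colliding p u≢u' e))

  collidingBefore : ℕ → ℕ
  collidingBefore k = length (filter (λ i → colliding? i ×-dec toℕ i <? k) (allFin n))

  collidingBefore≤numColliding : ∀ k → collidingBefore k ≤ numColliding
  collidingBefore≤numColliding k = length-filter-mono _ colliding? proj₁ (allFin n)

  collidingBefore-mono : ∀ k → collidingBefore k ≤ collidingBefore (suc k)
  collidingBefore-mono k = length-filter-mono _ _ (λ (c , i<k) → c , m≤n⇒m≤1+n i<k) (allFin n)

  collidingBefore-< : ∀ {k} (p : k < n) → Colliding (fromℕ< p) → collidingBefore k < collidingBefore (suc k)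
  collidingBefore-< p coll = length-filter-mono-< _ _ (λ (c , i<k) → c , m≤n⇒m≤1+n i<k)
    (∈-allFin (fromℕ< p)) (coll , s≤s (≤-reflexive (toℕ-fromℕ< p))) (λ (_ , k<k) → <-irrefl (toℕ-fromℕ< p) k<k)

  hit? : ∀ k q v → Dec (0 < hits B k q v)
  hit? k q v = 0 <? hits B k q v

  support : ∀ k → k ≤ n → Subset (size k)
  support k q = subset (hit? k q)

  ∣support∣≤w : ∀ k q → ∣ support k q ∣ ≤ w
  ∣support∣≤w k q = ≤-trans (∣p∣≤n (support k q)) (width k q)

  next-∈-support : ∀ k (p : k < n) b {u} → u ∈ support k (<⇒≤ p) → next k p u b ∈ support (suc k) p
  next-∈-support k p b {u} u∈ =
    ∈-subset⁺ (hit? (suc k) p) (positive (∈-subset⁻ (hit? k (<⇒≤ p)) u∈))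
    where
    positive : 0 < hits B k (<⇒≤ p) u → 0 < hits B (suc k) p (next k p u b)
    positive 0<h = *-cancelˡ-< 2 0 _ (<-≤-trans 0<h (hits≤2*hits-next k p u b))

  ∣support∣-mono : ∀ k (p : k < n) → ¬ Colliding (fromℕ< p) → ∣ support k (<⇒≤ p) ∣ ≤ ∣ support (suc k) p ∣
  ∣support∣-mono k p ¬coll =
    injection⇒∣p∣≤∣q∣ (λ u → next k p u pos) (¬Colliding⇒next-injective p pos ¬coll) (next-∈-support k p pos)

  ∣support∣-< : ∀ k (p : k < n) b {t} → ¬ Colliding (fromℕ< p) → t ∈ support (suc k) p →
    (∀ {u} → u ∈ support k (<⇒≤ p) → next k p u b ≢ t) → ∣ support k (<⇒≤ p) ∣ < ∣ support (suc k) p ∣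
  ∣support∣-< k p b ¬coll =
    injection-missing⇒∣p∣<∣q∣ (λ u → next k p u b) (¬Colliding⇒next-injective p b ¬coll) (next-∈-support k p b)

  potential : ∀ k → k ≤ n → ℕ
  potential k q = collidingBefore k * (w ∸ 1) + ∣ support k q ∣

  potential-colliding : ∀ k (p : k < n) → Colliding (fromℕ< p) → 1 < ∣ support (suc k) p ∣ →
    suc (potential k (<⇒≤ p)) ≤ potential (suc k) p
  potential-colliding k p coll 1<∣S∣ = begin
    suc (collidingBefore k * W + ∣ support k (<⇒≤ p) ∣)
      ≤⟨ s≤s (+-monoʳ-≤ (collidingBefore k * W) (≤-trans (∣support∣≤w k (<⇒≤ p)) (m≤n+m∸n w 1))) ⟩
    suc (collidingBefore k * W + suc W)
      ≡⟨ rearrange (collidingBefore k) W ⟩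
    suc (collidingBefore k) * W + 2
      ≤⟨ +-mono-≤ (*-monoˡ-≤ W (collidingBefore-< p coll)) 1<∣S∣ ⟩
    potential (suc k) p ∎
    where
    open ≤-Reasoning
    W = w ∸ 1
    rearrange : ∀ a W → suc (a * W + suc W) ≡ suc a * W + 2
    rearrange = solve-∀

  potential-mono : ∀ k (p : k < n) → ¬ Colliding (fromℕ< p) → potential k (<⇒≤ p) ≤ potential (suc k) p
  potential-mono k p ¬coll = +-mono-≤ (*-monoˡ-≤ (w ∸ 1) (collidingBefore-mono k)) (∣support∣-mono k p ¬coll)

  potential-grows : ∀ k (p : k < n) b {t} → ¬ Colliding (fromℕ< p) → t ∈ support (suc k) p →
    (∀ {u} → u ∈ support k (<⇒≤ p) → next k p u b ≢ t) → suc (potential k (<⇒≤ p)) ≤ potential (suc k) p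
  potential-grows k p b ¬coll t∈S f≢t = ≤-trans (≤-reflexive (sym (+-suc _ _)))
    (+-mono-≤ (*-monoˡ-≤ (w ∸ 1) (collidingBefore-mono k)) (∣support∣-< k p b ¬coll t∈S f≢t))

  potential≤ : ∀ {ℓ} → numColliding ≤ ℓ → ∀ k q → potential k q ≤ suc ((ℓ + 1) * (w ∸ 1))
  potential≤ {ℓ} few k q = begin
    collidingBefore k * W + ∣ support k q ∣
      ≤⟨ +-mono-≤ (*-monoˡ-≤ W (≤-trans (collidingBefore≤numColliding k) few))
                  (≤-trans (∣support∣≤w k q) (m≤n+m∸n w 1)) ⟩
    ℓ * W + suc W
      ≡⟨ rearrange ℓ W ⟩
    suc ((ℓ + 1) * W) ∎
    where
    open ≤-Reasoning
    W = w ∸ 1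
    rearrange : ∀ ℓ W → ℓ * W + suc W ≡ suc ((ℓ + 1) * W)
    rearrange = solve-∀

  HitsBound-at : ∀ k (q : k ≤ n) → Fin (size k) → Set
  HitsBound-at k q v = 2 ^ suc n ≤ hits B k q v * 2 ^ potential k q

  HitsBound : ∀ k → k ≤ n → Set
  HitsBound k q = ∀ v → 0 < hits B k q v → HitsBound-at k q v

  hitsBound-singleton : ∀ k q → ∣ support k q ∣ ≤ 1 → HitsBound k q
  hitsBound-singleton k q ∣S∣≤1 v v-hit = begin
    2 ^ suc n                        ≡⟨ *-comm 2 (2 ^ n) ⟩
    2 ^ n * 2 ^ 1                    ≤⟨ *-monoʳ-≤ (2 ^ n) (^-monoʳ-≤ 2 1≤potential) ⟩
    2 ^ n * 2 ^ potential k q        ≡⟨ cong (_* 2 ^ potential k q) (hits-all k q v everyone-reaches-v) ⟨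
    hits B k q v * 2 ^ potential k q ∎
    where
    open ≤-Reasoning
    v∈S : v ∈ support k q
    v∈S = ∈-subset⁺ (hit? k q) v-hit
    everyone-reaches-v : ∀ x → reach x k q ≡ v
    everyone-reaches-v x = ∣p∣≤1⇒∈-unique ∣S∣≤1 (∈-subset⁺ (hit? k q) (reach-hits x k q)) v∈S
    1≤potential : 1 ≤ potential k q
    1≤potential = ≤-trans (≤-<-trans z≤n (x∈p⇒∣p-x∣<∣p∣ v∈S)) (m≤n+m _ _)

  halving-bound : ∀ k (p : k < n) u b → HitsBound-at k (<⇒≤ p) u →
    suc (potential k (<⇒≤ p)) ≤ potential (suc k) p → HitsBound-at (suc k) p (next k p u b)
  halving-bound k p u b bound-u E<E' = raise-≤ (hits B (suc k) p (next k p u b)) (suc E) (potential (suc k) p)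
    (halve-≤ (hits B k (<⇒≤ p) u) (hits B (suc k) p (next k p u b)) E bound-u (hits≤2*hits-next k p u b)) E<E'
    where E = potential k (<⇒≤ p)

  averaging-bound : ∀ k (p : k < n) {u u'} b → next k p u b ≡ next k p u' (opposite b) →
    HitsBound-at k (<⇒≤ p) u → HitsBound-at k (<⇒≤ p) u' →
    potential k (<⇒≤ p) ≤ potential (suc k) p → HitsBound-at (suc k) p (next k p u b)
  averaging-bound k p {u} {u'} b e bound-u bound-u' E≤E' = raise-≤ (hits B (suc k) p (next k p u b)) E (potential (suc k) p)
    (average-≤ (hits B k (<⇒≤ p) u) (hits B k (<⇒≤ p) u') (hits B (suc k) p (next k p u b)) E
      bound-u bound-u' (hits+hits≤2*hits-next k p b e)) E≤E'
    where E = potential k (<⇒≤ p)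

  hitsBound-step : ∀ k (p : k < n) → HitsBound k (<⇒≤ p) → HitsBound (suc k) p
  hitsBound-step k p IH t t-hit with ∣ support (suc k) p ∣ ≤? 1
  ... | yes ∣S∣≤1 = hitsBound-singleton (suc k) p ∣S∣≤1 t t-hit
  ... | no  ∣S∣≰1 with hit-predecessor k p t t-hit
  ... | u , b , refl , u-hit with colliding? (fromℕ< p)
  ... | yes coll = halving-bound k p u b (IH u u-hit) (potential-colliding k p coll (≰⇒> ∣S∣≰1))
  ... | no ¬coll with any? (λ u' → hit? k (<⇒≤ p) u' ×-dec next k p u' (opposite b) Fin.≟ next k p u b)
  ... | yes (u' , u'-hit , e) = averaging-bound k p b (sym e) (IH u u-hit) (IH u' u'-hit) (potential-mono k p ¬coll)
  ... | no ∄u' = halving-bound k p u b (IH u u-hit)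
    (potential-grows k p (opposite b) ¬coll (∈-subset⁺ (hit? (suc k) p) t-hit)
      (λ u'∈S e → ∄u' (_ , ∈-subset⁻ (hit? k (<⇒≤ p)) u'∈S , e)))

  hitsBound : ∀ k q → HitsBound k q
  hitsBound zero    q = hitsBound-singleton zero q (subst (∣ support 0 q ∣ ≤_) size0 (∣p∣≤n (support 0 q)))
  hitsBound (suc k) p = hitsBound-step k p (hitsBound k (<⇒≤ p))

claim7p5 : (n w ℓ : ℕ) (B : BP n w) → BP.numColliding B ≤ ℓ →
    (k : ℕ) (p : k ≤ n) (v : Fin (BP.size B k)) →
    0 < hits B k p v →
    2 ^ n ≤ hits B k p v * 2 ^ ((ℓ + 1) * (w ∸ 1))
claim7p5 n w ℓ B few k p v v-hit = *-cancelˡ-≤ 2 (begin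
  2 ^ suc n                          ≤⟨ hitsBound B k p v v-hit ⟩
  hits B k p v * 2 ^ potential B k p ≤⟨ *-monoʳ-≤ (hits B k p v) (^-monoʳ-≤ 2 (potential≤ B few k p)) ⟩
  hits B k p v * 2 ^ suc Y           ≡⟨ reassoc (hits B k p v) (2 ^ Y) ⟩
  2 * (hits B k p v * 2 ^ Y)         ∎)
  where
  open ≤-Reasoning
  Y = (ℓ + 1) * (w ∸ 1)
  reassoc : ∀ h y → h * (2 * y) ≡ 2 * (h * y)
  reassoc = solve-∀
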